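{- Let $\Sigma$ be a finite signature and $\mathcal{T}$ any $\Sigma$-theory. If $L_1$ and $L_2$ are $\mathcal{T}$-regular $\mathcal{T}$-languages, then $L_1\cap L_2$ and $L_1\cup L_2$ are $\mathcal{T}$-regular.
   Context: Signatures are multi-sorted first-order signatures in which every symbol is marked either rigid or non-rigid. For a signature $\Sigma$, $\Sigma'$ denotes the signature obtained from $\Sigma$ by replacing each non-rigid symbol $s$ by a fresh primed copy $s'$ (rigid symbols are kept); for a $\Sigma$-structure $\sigma$, $\sigma'$ denotes the corresponding renamed $\Sigma'$-structure. For structures over pairwise disjoint signatures with the same sort domains, $\rho\cup\sigma\cup\tau'$ denotes the combined structure over the union of the signatures. A $\Sigma$-theory $\mathcal{T}$ is a set of $\Sigma$-sentences; $[\![\mathcal{T}]\!]$ is the set of all $\Sigma$-structures with finite or countably infinite domains that satisfy $\mathcal{T}$. A $\mathcal{T}$-word is a finite sequence $\bar\sigma=\langle\sigma_0,\ldots,\sigma_{n-1}\rangle$ ($n\ge 0$) of elements of $[\![\mathcal{T}]\!]$ such that for every sort $S$ and every rigid symbol $s$ of $\Sigma$, $S^{\sigma_i}=S^{\sigma_j}$ and $s^{\sigma_i}=s^{\sigma_j}$ for all $i,j$. $[\![\mathcal{T}]\!]^*$ is the set of all $\mathcal{T}$-words; a $\mathcal{T}$-language is a subset of $[\![\mathcal{T}]\!]^*$. A first-order automaton is a tuple $\mathcal{A}=\langle\Sigma,\Gamma,\phi_0,\phi_T,\phi_F\rangle$ where $\Sigma$ (word signature) and $\Gamma$ (state signature)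 are finite disjoint signatures, $\phi_0$ and $\phi_F$ are first-order $\Gamma$-sentences, and $\phi_T$ is a first-order $(\Gamma\cup\Sigma\cup\Gamma')$-sentence. Given a $\mathcal{T}$-word $\bar\sigma=\langle\sigma_0,\ldots,\sigma_{n-1}\rangle$, a $\mathcal{T}$-run of $\mathcal{A}$ induced by $\bar\sigma$ is a sequence $\langle\rho_0,\ldots,\rho_n\rangle$ of $\Gamma$-structures such that $S^{\rho_i}=S^{\sigma_0}$ for every sort $S$ and every $i$, rigid symbols of $\Gamma$ are interpreted identically in all $\rho_i$, $\rho_0\models\phi_0$, and $\rho_i\cup\sigma_i\cup\rho'_{i+1}\models\phi_T$ for all $0\le i<n$. $\mathcal{A}$ $\mathcal{T}$-accepts $\bar\sigma$ iff some such run satisfies $\rho_n\models\phi_F$. $\mathcal{L}_{\mathcal{T}}(\mathcal{A})$ is the set of $\mathcal{T}$-words $\mathcal{T}$-accepted by $\mathcal{A}$. A $\mathcal{T}$-language $L$ is $\mathcal{T}$-regular iff $L=\mathcal{L}_{\mathcal{T}}(\mathcal{A})$ for some first-order automaton $\mathcal{A}$ with word signature $\Sigma$. -}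

module Defs where

open import Level using (Level; 0ℓ) renaming (suc to lsuc)
open import Data.Nat using (ℕ; zero; suc)
open import Data.Fin using (Fin; zero; suc; inject₁; fromℕ)
open import Data.Bool using (Bool; true; false)
open import Data.List using (List; []; _∷_)
open import Data.List.Membership.Propositional using (_∈_)
open import Data.List.Relation.Unary.All using (All; []; _∷_; lookup)
open import Data.Product using (Σ; Σ-syntax; _×_; _,_; proj₁; proj₂)
open import Data.Sum using (_⊎_; inj₁; inj₂)
open import Data.Unit using (⊤)
open import Data.Empty using (⊥)
open import Relation.Nullary using (¬_)
open import Relation.Binary.PropositionalEquality using (_≡_)
open import Function.Bundles using (_↔_; _⇔_)
open import Function.Definitions using (Injective)

record Sig (Sort : Set) : Set₁ where
  field
    Fun    : Set
    Rel    : Set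
    dom    : Fun → List Sort
    cod    : Fun → Sort
    rdom   : Rel → List Sort
    rigidF : Fun → Bool
    rigidR : Rel → Bool
open Sig public

FiniteType : Set → Set
FiniteType A = Σ[ n ∈ ℕ ] (A ↔ Fin n)

FiniteSig : {Sort : Set} → Sig Sort → Set
FiniteSig {Sort} Ξ = FiniteType Sort × FiniteType (Fun Ξ) × FiniteType (Rel Ξ)

_⊕_ : {Sort : Set} → Sig Sort → Sig Sort → Sig Sort
_⊕_ {Sort} Ξ Θ = record
  { Fun = Fun Ξ ⊎ Fun Θ ; Rel = Rel Ξ ⊎ Rel Θ
  ; dom = λ { (inj₁ f) → dom Ξ f ; (inj₂ f) → dom Θ f }
  ; cod = λ { (inj₁ f) → cod Ξ f ; (inj₂ f) → cod Θ f }
  ; rdom = λ { (inj₁ r) → rdom Ξ r ; (inj₂ r) → rdom Θ r }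
  ; rigidF = λ { (inj₁ f) → rigidF Ξ f ; (inj₂ f) → rigidF Θ f }
  ; rigidR = λ { (inj₁ r) → rigidR Ξ r ; (inj₂ r) → rigidR Θ r } }

-- The fresh primed copies s' of the NON-rigid symbols of Ξ.
-- (Rigid symbols are shared between Ξ and Ξ', so Ξ ∪ Ξ' = Ξ ⊕ Primed Ξ.)
Primed : {Sort : Set} → Sig Sort → Sig Sort
Primed Ξ = record
  { Fun = Σ[ f ∈ Fun Ξ ] (rigidF Ξ f ≡ false)
  ; Rel = Σ[ r ∈ Rel Ξ ] (rigidR Ξ r ≡ false)
  ; dom = λ f → dom Ξ (proj₁ f) ; cod = λ f → cod Ξ (proj₁ f)
  ; rdom = λ r → rdom Ξ (proj₁ r)
  ; rigidF = λ _ → false ; rigidR = λ _ → false }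

TransSig : {Sort : Set} → Sig Sort → Sig Sort → Sig Sort
TransSig Γ Ξ = Γ ⊕ (Ξ ⊕ Primed Γ)

module _ {Sort : Set} (Ξ : Sig Sort) where
  mutual
    data Term (Δ : List Sort) : Sort → Set where
      var : {s : Sort} → s ∈ Δ → Term Δ s
      app : (f : Fun Ξ) → Terms Δ (dom Ξ f) → Term Δ (cod Ξ f)

    data Terms (Δ : List Sort) : List Sort → Set where
      []  : Terms Δ []
      _∷_ : {s : Sort} {ss : List Sort} → Term Δ s → Terms Δ ss → Terms Δ (s ∷ ss)

  data Formula (Δ : List Sort) : Set where
    tt ff  : Formula Δ
    rel    : (r : Rel Ξ) → Terms Δ (rdom Ξ r) → Formula Δ
    eq     : {s : Sort} → Term Δ s → Term Δ s → Formula Δ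
    not    : Formula Δ → Formula Δ
    and or imp : Formula Δ → Formula Δ → Formula Δ
    all ex : (s : Sort) → Formula (s ∷ Δ) → Formula Δ

  Sentence : Set
  Sentence = Formula []

record Str {Sort : Set} (Ξ : Sig Sort) (D : Sort → Set) : Set₁ where
  field
    funI : (f : Fun Ξ) → All D (dom Ξ f) → D (cod Ξ f)
    relI : (r : Rel Ξ) → All D (rdom Ξ r) → Set
open Str public

module _ {Sort : Set} {Ξ : Sig Sort} {D : Sort → Set} (M : Str Ξ D) where
  mutual
    evalT : {Δ : List Sort} {s : Sort} → All D Δ → Term Ξ Δ s → D s
    evalT e (var x)    = lookup e x
    evalT e (app f ts) = funI M f (evalTs e ts)

    evalTs : {Δ ss : List Sort} → All D Δ → Terms Ξ Δ ss → All D ss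
    evalTs e []       = []
    evalTs e (t ∷ ts) = evalT e t ∷ evalTs e ts

  Sat : {Δ : List Sort} → All D Δ → Formula Ξ Δ → Set
  Sat e tt          = ⊤
  Sat e ff          = ⊥
  Sat e (Formula.rel r ts) = relI M r (evalTs e ts)
  Sat e (eq t u)    = evalT e t ≡ evalT e u
  Sat e (not φ)     = ¬ Sat e φ
  Sat e (and φ ψ)   = Sat e φ × Sat e ψ
  Sat e (or φ ψ)    = Sat e φ ⊎ Sat e ψ
  Sat e (imp φ ψ)   = Sat e φ → Sat e ψ
  Sat e (all s φ)   = (d : D s) → Sat (d ∷ e) φ
  Sat e (ex s φ)    = Σ[ d ∈ D s ] Sat (d ∷ e) φ

  _⊨_ : Sentence Ξ → Set
  _⊨_ φ = Sat [] φ

combine : {Sort : Set} {Γ Ξ : Sig Sort} {D : Sort → Set} →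
          Str Γ D → Str Ξ D → Str Γ D → Str (TransSig Γ Ξ) D
combine ρ σ τ = record
  { funI = λ { (inj₁ f) → funI ρ f ; (inj₂ (inj₁ f)) → funI σ f
            ; (inj₂ (inj₂ (f , _))) → funI τ f }
  ; relI = λ { (inj₁ r) → relI ρ r ; (inj₂ (inj₁ r)) → relI σ r
            ; (inj₂ (inj₂ (r , _))) → relI τ r } }

SameRigid : {Sort : Set} {Ξ : Sig Sort} {D : Sort → Set} → Str Ξ D → Str Ξ D → Set
SameRigid {Ξ = Ξ} M N =
  ((f : Fun Ξ) → rigidF Ξ f ≡ true → (a : All _ (dom Ξ f)) → funI M f a ≡ funI N f a) ×
  ((r : Rel Ξ) → rigidR Ξ r ≡ true → (a : All _ (rdom Ξ r)) → relI M r a ⇔ relI N r a)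

Theory : {Sort : Set} → Sig Sort → Set₁
Theory Ξ = Sentence Ξ → Set

-- admissible sort domains: nonempty and finite or countably infinite
-- (i.e. injectable into ℕ)
Countable : Set → Set
Countable A = Σ[ f ∈ (A → ℕ) ] Injective _≡_ _≡_ f

GoodDomains : {Sort : Set} → (Sort → Set) → Set
GoodDomains {Sort} D = (s : Sort) → D s × Countable (D s)

-- σ ∈ ⟦T⟧ (domain conditions are imposed once for the whole word)
Models : {Sort : Set} {Ξ : Sig Sort} {D : Sort → Set} → Str Ξ D → Theory Ξ → Set
Models σ T = ∀ φ → T φ → σ ⊨ φ

record TWord {Sort : Set} (Ξ : Sig Sort) (T : Theory Ξ) : Set₁ where
  field
    D      : Sort → Set
    goodD  : GoodDomains D
    len    : ℕ
    σ      : Fin len → Str Ξ D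
    models : (i : Fin len) → Models (σ i) T
    rigid  : (i j : Fin len) → SameRigid (σ i) (σ j)
open TWord public

TLang : {Sort : Set} (Ξ : Sig Sort) → Theory Ξ → Set₂
TLang Ξ T = TWord Ξ T → Set₁

_∩L_ _∪L_ : {Sort : Set} {Ξ : Sig Sort} {T : Theory Ξ} → TLang Ξ T → TLang Ξ T → TLang Ξ T
(L₁ ∩L L₂) w = L₁ w × L₂ w
(L₁ ∪L L₂) w = L₁ w ⊎ L₂ w

record Automaton {Sort : Set} (Ξ : Sig Sort) : Set₁ where
  field
    Γ    : Sig Sort
    finΓ : FiniteSig Γ
    φ₀   : Sentence Γ
    φT   : Sentence (TransSig Γ Ξ)
    φF   : Sentence Γ
open Automaton public

record AcceptingRun {Sort : Set} {Ξ : Sig Sort} {T : Theory Ξ}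
                    (A : Automaton Ξ) (w : TWord Ξ T) : Set₁ where
  field
    ρ      : Fin (suc (len w)) → Str (Γ A) (D w)
    rigid  : (i j : Fin (suc (len w))) → SameRigid (ρ i) (ρ j)
    init   : ρ zero ⊨ φ₀ A
    trans  : (i : Fin (len w)) → combine (ρ (inject₁ i)) (σ w i) (ρ (suc i)) ⊨ φT A
    final  : ρ (fromℕ (len w)) ⊨ φF A

Accepts : {Sort : Set} {Ξ : Sig Sort} {T : Theory Ξ} →
          Automaton Ξ → TWord Ξ T → Set₁
Accepts A w = AcceptingRun A w

Regular : {Sort : Set} {Ξ : Sig Sort} {T : Theory Ξ} → TLang Ξ T → Set₁
Regular {Ξ = Ξ} {T} L =
  Σ[ A ∈ Automaton Ξ ] ((w : TWord Ξ T) → L w ⇔ Accepts A w)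

{-# OPTIONS --safe #-}
-- Both automata are run side by side on the disjoint union of their state
-- signatures; sentences are moved into the larger signature by renaming
-- symbols, which preserves satisfaction relative to reducts.  For the
-- intersection every formula is the conjunction of the two components.  For
-- the union a rigid nullary relation (the flag) is added and every formula
-- says "flag and A's formula, or not flag and B's formula"; rigidity forces
-- the flag to be constant along a run, so an accepting run is an accepting
-- run of one component, while the other component idles in an arbitrary
-- structure over the (nonempty) domains.
module Submission where

open import Defs
open import Data.Bool using (true)
open import Data.Empty using (⊥; ⊥-elim)
open import Data.Fin using (Fin; zero; suc; inject₁; fromℕ)
open import Data.Fin.Properties using (+↔⊎; 0↔⊥; 1↔⊤)
open import Data.List using (List; [])
open import Data.List.Relation.Unary.All using (All; []; _∷_)
open import Data.Nat using (suc; _+_)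
open import Data.Product using (_×_; _,_; proj₁; proj₂; map₂)
open import Data.Product.Function.NonDependent.Propositional using (_×-⇔_)
open import Data.Sum using (_⊎_; inj₁; inj₂)
open import Data.Sum.Function.Propositional using (_⊎-⇔_; _⊎-↔_)
open import Data.Unit using (⊤; tt)
open import Function using (_∘_)
open import Function.Bundles using (_⇔_; mk⇔; Equivalence)
open import Function.Construct.Composition using (_⇔-∘_)
open import Function.Construct.Identity using (⇔-id)
open import Function.Construct.Symmetry using (⇔-sym)
open import Function.Properties.Inverse using (↔-sym; ↔-trans)
open import Function.Related.TypeIsomorphisms using (¬-cong-⇔; →-cong-⇔)
open import Relation.Binary.PropositionalEquality using (_≡_; refl; cong; cong₂; subst)
open import Relation.Nullary using (¬_)

open Equivalence using (to; from)

module Run = AcceptingRun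

FiniteType-⊎ : {X Y : Set} → FiniteType X → FiniteType Y → FiniteType (X ⊎ Y)
FiniteType-⊎ (n , X↔n) (m , Y↔m) = n + m , ↔-trans (X↔n ⊎-↔ Y↔m) (↔-sym +↔⊎)

module _ {B P Q : Set} where

  branch-then : B → (B × P) ⊎ (¬ B × Q) → P
  branch-then _ (inj₁ (_ , p))  = p
  branch-then b (inj₂ (¬b , _)) = ⊥-elim (¬b b)

  branch-else : ¬ B → (B × P) ⊎ (¬ B × Q) → Q
  branch-else ¬b (inj₁ (b , _)) = ⊥-elim (¬b b)
  branch-else _  (inj₂ (_ , q)) = q

module _ {Sort : Set} where

  record Translation (Ξ Θ : Sig Sort) : Set₁ where
    field
      translateFun : ∀ {Δ} (f : Fun Ξ) → Terms Θ Δ (dom Ξ f) → Term Θ Δ (cod Ξ f)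
      translateRel : ∀ {Δ} (r : Rel Ξ) → Terms Θ Δ (rdom Ξ r) → Formula Θ Δ
  open Translation

  module _ {Ξ Θ : Sig Sort} (m : Translation Ξ Θ) where

    mutual
      translateTerm : ∀ {Δ s} → Term Ξ Δ s → Term Θ Δ s
      translateTerm (var x)    = var x
      translateTerm (app f ts) = translateFun m f (translateTerms ts)

      translateTerms : ∀ {Δ ss} → Terms Ξ Δ ss → Terms Θ Δ ss
      translateTerms []       = []
      translateTerms (t ∷ ts) = translateTerm t ∷ translateTerms ts

    translate : ∀ {Δ} → Formula Ξ Δ → Formula Θ Δ
    translate tt         = tt
    translate ff         = ff
    translate (rel r ts) = translateRel m r (translateTerms ts)
    translate (eq t u)   = eq (translateTerm t) (translateTerm u)
    translate (not φ)    = not (translate φ)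
    translate (and φ ψ)  = and (translate φ) (translate ψ)
    translate (or φ ψ)   = or (translate φ) (translate ψ)
    translate (imp φ ψ)  = imp (translate φ) (translate ψ)
    translate (all s φ)  = all s (translate φ)
    translate (ex s φ)   = ex s (translate φ)

    record IsReduct {D : Sort → Set} (M : Str Θ D) (N : Str Ξ D) : Set₁ where
      field
        fun-reduct : ∀ {Δ} (e : All D Δ) f ts →
                     evalT M e (translateFun m f ts) ≡ funI N f (evalTs M e ts)
        rel-reduct : ∀ {Δ} (e : All D Δ) r ts →
                     Sat M e (translateRel m r ts) ⇔ relI N r (evalTs M e ts)

    module _ {D : Sort → Set} {M : Str Θ D} {N : Str Ξ D} (M↾N : IsReduct M N) where
      open IsReduct M↾N

      mutual
        evalT-translate : ∀ {Δ s} (e : All D Δ) (t : Term Ξ Δ s) →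
                          evalT M e (translateTerm t) ≡ evalT N e t
        evalT-translate e (var x)    = refl
        evalT-translate e (app f ts) rewrite fun-reduct e f (translateTerms ts) =
          cong (funI N f) (evalTs-translate e ts)

        evalTs-translate : ∀ {Δ ss} (e : All D Δ) (ts : Terms Ξ Δ ss) →
                           evalTs M e (translateTerms ts) ≡ evalTs N e ts
        evalTs-translate e []       = refl
        evalTs-translate e (t ∷ ts) = cong₂ _∷_ (evalT-translate e t) (evalTs-translate e ts)

      Sat-translate : ∀ {Δ} (e : All D Δ) (φ : Formula Ξ Δ) →
                      Sat M e (translate φ) ⇔ Sat N e φ
      Sat-translate e tt         = ⇔-id _
      Sat-translate e ff         = ⇔-id _
      Sat-translate e (rel r ts) = subst (λ a → _ ⇔ relI N r a) (evalTs-translate e ts)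
                                         (rel-reduct e r (translateTerms ts))
      Sat-translate e (eq t u) rewrite evalT-translate e t | evalT-translate e u = ⇔-id _
      Sat-translate e (not φ)    = ¬-cong-⇔ (Sat-translate e φ)
      Sat-translate e (and φ ψ)  = Sat-translate e φ ×-⇔ Sat-translate e ψ
      Sat-translate e (or φ ψ)   = Sat-translate e φ ⊎-⇔ Sat-translate e ψ
      Sat-translate e (imp φ ψ)  = →-cong-⇔ (Sat-translate e φ) (Sat-translate e ψ)
      Sat-translate e (all s φ)  = mk⇔ (λ h d → to (Sat-translate (d ∷ e) φ) (h d))
                                       (λ h d → from (Sat-translate (d ∷ e) φ) (h d))
      Sat-translate e (ex s φ)   = mk⇔ (map₂ λ {d} → to (Sat-translate (d ∷ e) φ))
                                       (map₂ λ {d} → from (Sat-translate (d ∷ e) φ))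

      ⊨-translate : (φ : Sentence Ξ) → M ⊨ translate φ ⇔ N ⊨ φ
      ⊨-translate = Sat-translate []

  module _ {A B : Sig Sort} {D : Sort → Set} where

    _⊕ₛ_ : Str A D → Str B D → Str (A ⊕ B) D
    M ⊕ₛ N = record { funI = λ { (inj₁ f) → funI M f ; (inj₂ f) → funI N f }
                    ; relI = λ { (inj₁ r) → relI M r ; (inj₂ r) → relI N r } }

    reductˡ : Str (A ⊕ B) D → Str A D
    reductˡ M = record { funI = funI M ∘ inj₁ ; relI = relI M ∘ inj₁ }

    reductʳ : Str (A ⊕ B) D → Str B D
    reductʳ M = record { funI = funI M ∘ inj₂ ; relI = relI M ∘ inj₂ }

    SameRigid-⊕ₛ : {M M′ : Str A D} {N N′ : Str B D} →
                   SameRigid M M′ → SameRigid N N′ → SameRigid (M ⊕ₛ N) (M′ ⊕ₛ N′)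
    SameRigid-⊕ₛ (fM , rM) (fN , rN) = (λ { (inj₁ f) → fM f ; (inj₂ f) → fN f })
                                     , (λ { (inj₁ r) → rM r ; (inj₂ r) → rN r })

    SameRigid-reductˡ : {M N : Str (A ⊕ B) D} →
                        SameRigid M N → SameRigid (reductˡ M) (reductˡ N)
    SameRigid-reductˡ (f , r) = f ∘ inj₁ , r ∘ inj₁

    SameRigid-reductʳ : {M N : Str (A ⊕ B) D} →
                        SameRigid M N → SameRigid (reductʳ M) (reductʳ N)
    SameRigid-reductʳ (f , r) = f ∘ inj₂ , r ∘ inj₂

  constStr : {Ξ : Sig Sort} {D : Sort → Set} → ((s : Sort) → D s) → Str Ξ D
  constStr {Ξ} c = record { funI = λ f _ → c (cod Ξ f) ; relI = λ _ _ → ⊤ }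

  SameRigid-refl : {Ξ : Sig Sort} {D : Sort → Set} {M : Str Ξ D} → SameRigid M M
  SameRigid-refl = (λ _ _ _ → refl) , (λ _ _ _ → ⇔-id _)

  module _ {A B : Sig Sort} where

    inl : Translation A (A ⊕ B)
    inl = record { translateFun = app ∘ inj₁ ; translateRel = rel ∘ inj₁ }

    inr : Translation B (A ⊕ B)
    inr = record { translateFun = app ∘ inj₂ ; translateRel = rel ∘ inj₂ }

    module _ {Ξ : Sig Sort} where

      inlᵀ : Translation (TransSig A Ξ) (TransSig (A ⊕ B) Ξ)
      inlᵀ = record
        { translateFun = λ { (inj₁ f)               → app (inj₁ (inj₁ f))
                           ; (inj₂ (inj₁ f))        → app (inj₂ (inj₁ f))
                           ; (inj₂ (inj₂ (f , p)))  → app (inj₂ (inj₂ (inj₁ f , p))) }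
        ; translateRel = λ { (inj₁ r)               → rel (inj₁ (inj₁ r))
                           ; (inj₂ (inj₁ r))        → rel (inj₂ (inj₁ r))
                           ; (inj₂ (inj₂ (r , p)))  → rel (inj₂ (inj₂ (inj₁ r , p))) } }

      inrᵀ : Translation (TransSig B Ξ) (TransSig (A ⊕ B) Ξ)
      inrᵀ = record
        { translateFun = λ { (inj₁ f)               → app (inj₁ (inj₂ f))
                           ; (inj₂ (inj₁ f))        → app (inj₂ (inj₁ f))
                           ; (inj₂ (inj₂ (f , p)))  → app (inj₂ (inj₂ (inj₂ f , p))) }
        ; translateRel = λ { (inj₁ r)               → rel (inj₁ (inj₂ r))
                           ; (inj₂ (inj₁ r))        → rel (inj₂ (inj₁ r))
                           ; (inj₂ (inj₂ (r , p)))  → rel (inj₂ (inj₂ (inj₂ r , p))) } }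

    module _ {D : Sort → Set} where

      ⊨-inl : (M : Str (A ⊕ B) D) (φ : Sentence A) →
              M ⊨ translate inl φ ⇔ reductˡ M ⊨ φ
      ⊨-inl M = ⊨-translate inl record
        { fun-reduct = λ _ _ _ → refl ; rel-reduct = λ _ _ _ → ⇔-id _ }

      ⊨-inr : (M : Str (A ⊕ B) D) (φ : Sentence B) →
              M ⊨ translate inr φ ⇔ reductʳ M ⊨ φ
      ⊨-inr M = ⊨-translate inr record
        { fun-reduct = λ _ _ _ → refl ; rel-reduct = λ _ _ _ → ⇔-id _ }

      module _ {Ξ : Sig Sort} (ρ : Str (A ⊕ B) D) (σ : Str Ξ D) (τ : Str (A ⊕ B) D) where

        ⊨-inlᵀ : (φ : Sentence (TransSig A Ξ)) →
                 combine ρ σ τ ⊨ translate inlᵀ φ ⇔ combine (reductˡ ρ) σ (reductˡ τ) ⊨ φ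
        ⊨-inlᵀ = ⊨-translate inlᵀ record
          { fun-reduct = λ { _ (inj₁ _) _ → refl ; _ (inj₂ (inj₁ _)) _ → refl
                           ; _ (inj₂ (inj₂ _)) _ → refl }
          ; rel-reduct = λ { _ (inj₁ _) _ → ⇔-id _ ; _ (inj₂ (inj₁ _)) _ → ⇔-id _
                           ; _ (inj₂ (inj₂ _)) _ → ⇔-id _ } }

        ⊨-inrᵀ : (φ : Sentence (TransSig B Ξ)) →
                 combine ρ σ τ ⊨ translate inrᵀ φ ⇔ combine (reductʳ ρ) σ (reductʳ τ) ⊨ φ
        ⊨-inrᵀ = ⊨-translate inrᵀ record
          { fun-reduct = λ { _ (inj₁ _) _ → refl ; _ (inj₂ (inj₁ _)) _ → refl
                           ; _ (inj₂ (inj₂ _)) _ → refl }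
          ; rel-reduct = λ { _ (inj₁ _) _ → ⇔-id _ ; _ (inj₂ (inj₁ _)) _ → ⇔-id _
                           ; _ (inj₂ (inj₂ _)) _ → ⇔-id _ } }

  module _ {A B C : Sig Sort} {D : Sort → Set} where

    ⊨-inl-inl : (M : Str ((A ⊕ B) ⊕ C) D) (φ : Sentence A) →
                M ⊨ translate inl (translate inl φ) ⇔ reductˡ (reductˡ M) ⊨ φ
    ⊨-inl-inl M φ = ⊨-inl (reductˡ M) φ ⇔-∘ ⊨-inl M (translate inl φ)

    ⊨-inl-inr : (M : Str ((A ⊕ B) ⊕ C) D) (φ : Sentence B) →
                M ⊨ translate inl (translate inr φ) ⇔ reductʳ (reductˡ M) ⊨ φ
    ⊨-inl-inr M φ = ⊨-inr (reductˡ M) φ ⇔-∘ ⊨-inl M (translate inr φ)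

    module _ {Ξ : Sig Sort} (ρ : Str ((A ⊕ B) ⊕ C) D) (σ : Str Ξ D)
             (τ : Str ((A ⊕ B) ⊕ C) D) where

      ⊨-inlᵀ-inlᵀ : (φ : Sentence (TransSig A Ξ)) →
                    combine ρ σ τ ⊨ translate inlᵀ (translate inlᵀ φ)
                    ⇔ combine (reductˡ (reductˡ ρ)) σ (reductˡ (reductˡ τ)) ⊨ φ
      ⊨-inlᵀ-inlᵀ φ = ⊨-inlᵀ (reductˡ ρ) σ (reductˡ τ) φ ⇔-∘ ⊨-inlᵀ ρ σ τ (translate inlᵀ φ)

      ⊨-inlᵀ-inrᵀ : (φ : Sentence (TransSig B Ξ)) →
                    combine ρ σ τ ⊨ translate inlᵀ (translate inrᵀ φ)
                    ⇔ combine (reductʳ (reductˡ ρ)) σ (reductʳ (reductˡ τ)) ⊨ φ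
      ⊨-inlᵀ-inrᵀ φ = ⊨-inrᵀ (reductˡ ρ) σ (reductˡ τ) φ ⇔-∘ ⊨-inlᵀ ρ σ τ (translate inrᵀ φ)

  FiniteSig-⊕ : {A B : Sig Sort} → FiniteSig A → FiniteSig B → FiniteSig (A ⊕ B)
  FiniteSig-⊕ (sorts , funsA , relsA) (_ , funsB , relsB) =
    sorts , FiniteType-⊎ funsA funsB , FiniteType-⊎ relsA relsB

  Flag : Sig Sort
  Flag = record { Fun = ⊥ ; Rel = ⊤ ; dom = λ () ; cod = λ () ; rdom = λ _ → []
                ; rigidF = λ () ; rigidR = λ _ → true }

  FiniteSig-Flag : FiniteType Sort → FiniteSig Flag
  FiniteSig-Flag sorts = sorts , (0 , ↔-sym 0↔⊥) , (1 , ↔-sym 1↔⊤)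

  flag : {A : Sig Sort} → Sentence (A ⊕ Flag)
  flag = rel (inj₂ tt) []

  flagᵀ : {A Ξ : Sig Sort} → Sentence (TransSig (A ⊕ Flag) Ξ)
  flagᵀ = rel (inj₁ (inj₂ tt)) []

  flagStr : {D : Sort → Set} → Set → Str Flag D
  flagStr P = record { funI = λ () ; relI = λ _ _ → P }

  branch : {Θ : Sig Sort} {Δ : List Sort} →
           Formula Θ Δ → Formula Θ Δ → Formula Θ Δ → Formula Θ Δ
  branch b φ ψ = or (and b φ) (and (not b) ψ)

  module _ {Ξ : Sig Sort} where

    _∩A_ : Automaton Ξ → Automaton Ξ → Automaton Ξ
    A ∩A B = record
      { Γ    = Γ A ⊕ Γ B
      ; finΓ = FiniteSig-⊕ {A = Γ A} {Γ B} (finΓ A) (finΓ B)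
      ; φ₀   = and (translate inl (φ₀ A)) (translate inr (φ₀ B))
      ; φT   = and (translate inlᵀ (φT A)) (translate inrᵀ (φT B))
      ; φF   = and (translate inl (φF A)) (translate inr (φF B)) }

    _∪A_ : Automaton Ξ → Automaton Ξ → Automaton Ξ
    A ∪A B = record
      { Γ    = Γ (A ∩A B) ⊕ Flag
      ; finΓ = FiniteSig-⊕ {A = Γ (A ∩A B)} {Flag} (finΓ (A ∩A B))
                                                  (FiniteSig-Flag (proj₁ (finΓ A)))
      ; φ₀   = branch flag (translate inl (translate inl (φ₀ A)))
                           (translate inl (translate inr (φ₀ B)))
      ; φT   = branch flagᵀ (translate inlᵀ (translate inlᵀ (φT A)))
                            (translate inlᵀ (translate inrᵀ (φT B)))
      ; φF   = branch flag (translate inl (translate inl (φF A)))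
                           (translate inl (translate inr (φF B))) }

  module _ {Ξ : Sig Sort} {T : Theory Ξ} (w : TWord Ξ T) where

    record Simulation (A B : Automaton Ξ) (Inv : Str (Γ A) (D w) → Set) : Set₁ where
      field
        state       : Str (Γ A) (D w) → Str (Γ B) (D w)
        state-rigid : ∀ {M N} → SameRigid M N → SameRigid (state M) (state N)
        state-init  : ∀ {M} → Inv M → M ⊨ φ₀ A → state M ⊨ φ₀ B
        state-trans : ∀ {ρ τ} → Inv ρ → (σ : Str Ξ (D w)) →
                      combine ρ σ τ ⊨ φT A → combine (state ρ) σ (state τ) ⊨ φT B
        state-final : ∀ {M} → Inv M → M ⊨ φF A → state M ⊨ φF B

    simulate : ∀ {A B Inv} → Simulation A B Inv →
               (r : Accepts A w) → (∀ i → Inv (Run.ρ r i)) → Accepts B w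
    simulate S r inv = record
      { ρ     = state ∘ Run.ρ r
      ; rigid = λ i j → state-rigid (Run.rigid r i j)
      ; init  = state-init (inv zero) (Run.init r)
      ; trans = λ i → state-trans (inv (inject₁ i)) (σ w i) (Run.trans r i)
      ; final = state-final (inv (fromℕ (len w))) (Run.final r) }
      where open Simulation S

    idle : {Θ : Sig Sort} → Str Θ (D w)
    idle = constStr (proj₁ ∘ goodD w)

    module _ {A B : Automaton Ξ} where

      pair-runs : Accepts A w → Accepts B w → Accepts (A ∩A B) w
      pair-runs r s = record
        { ρ     = ρ
        ; rigid = λ i j → SameRigid-⊕ₛ (Run.rigid r i j) (Run.rigid s i j)
        ; init  = from (⊨-inl (ρ zero) (φ₀ A)) (Run.init r)
                , from (⊨-inr (ρ zero) (φ₀ B)) (Run.init s)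
        ; trans = λ i → from (⊨-inlᵀ (ρ (inject₁ i)) (σ w i) (ρ (suc i)) (φT A)) (Run.trans r i)
                      , from (⊨-inrᵀ (ρ (inject₁ i)) (σ w i) (ρ (suc i)) (φT B)) (Run.trans s i)
        ; final = from (⊨-inl (ρ (fromℕ (len w))) (φF A)) (Run.final r)
                , from (⊨-inr (ρ (fromℕ (len w))) (φF B)) (Run.final s) }
        where
        ρ : Fin (suc (len w)) → Str (Γ A ⊕ Γ B) (D w)
        ρ i = Run.ρ r i ⊕ₛ Run.ρ s i

      ∩A-projˡ : Simulation (A ∩A B) A (λ _ → ⊤)
      ∩A-projˡ = record
        { state       = reductˡ
        ; state-rigid = SameRigid-reductˡ
        ; state-init  = λ {M} _ → to (⊨-inl M (φ₀ A)) ∘ proj₁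
        ; state-trans = λ {ρ τ} _ σ → to (⊨-inlᵀ ρ σ τ (φT A)) ∘ proj₁
        ; state-final = λ {M} _ → to (⊨-inl M (φF A)) ∘ proj₁ }

      ∩A-projʳ : Simulation (A ∩A B) B (λ _ → ⊤)
      ∩A-projʳ = record
        { state       = reductʳ
        ; state-rigid = SameRigid-reductʳ
        ; state-init  = λ {M} _ → to (⊨-inr M (φ₀ B)) ∘ proj₂
        ; state-trans = λ {ρ τ} _ σ → to (⊨-inrᵀ ρ σ τ (φT B)) ∘ proj₂
        ; state-final = λ {M} _ → to (⊨-inr M (φF B)) ∘ proj₂ }

      accepts-∩A : Accepts (A ∩A B) w ⇔ (Accepts A w × Accepts B w)
      accepts-∩A = mk⇔ (λ r → simulate ∩A-projˡ r _ , simulate ∩A-projʳ r _)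
                       (λ (r , s) → pair-runs r s)

      ∪A-injˡ : Simulation A (A ∪A B) (λ _ → ⊤)
      ∪A-injˡ = record
        { state       = state
        ; state-rigid = λ h → SameRigid-⊕ₛ (SameRigid-⊕ₛ h SameRigid-refl) SameRigid-refl
        ; state-init  = λ {M} _ h → inj₁ (tt , from (⊨-inl-inl (state M) (φ₀ A)) h)
        ; state-trans = λ {ρ τ} _ σ h →
                          inj₁ (tt , from (⊨-inlᵀ-inlᵀ (state ρ) σ (state τ) (φT A)) h)
        ; state-final = λ {M} _ h → inj₁ (tt , from (⊨-inl-inl (state M) (φF A)) h) }
        where
        state : Str (Γ A) (D w) → Str (Γ (A ∪A B)) (D w)
        state M = (M ⊕ₛ idle) ⊕ₛ flagStr ⊤

      ∪A-injʳ : Simulation B (A ∪A B) (λ _ → ⊤)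
      ∪A-injʳ = record
        { state       = state
        ; state-rigid = λ h → SameRigid-⊕ₛ (SameRigid-⊕ₛ SameRigid-refl h) SameRigid-refl
        ; state-init  = λ {M} _ h → inj₂ ((λ ()) , from (⊨-inl-inr (state M) (φ₀ B)) h)
        ; state-trans = λ {ρ τ} _ σ h →
                          inj₂ ((λ ()) , from (⊨-inlᵀ-inrᵀ (state ρ) σ (state τ) (φT B)) h)
        ; state-final = λ {M} _ h → inj₂ ((λ ()) , from (⊨-inl-inr (state M) (φF B)) h) }
        where
        state : Str (Γ B) (D w) → Str (Γ (A ∪A B)) (D w)
        state M = (idle ⊕ₛ M) ⊕ₛ flagStr ⊥

      ∪A-retractˡ : Simulation (A ∪A B) A (λ M → M ⊨ flag)
      ∪A-retractˡ = record
        { state       = reductˡ ∘ reductˡ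
        ; state-rigid = SameRigid-reductˡ ∘ SameRigid-reductˡ
        ; state-init  = λ {M} on → to (⊨-inl-inl M (φ₀ A)) ∘ branch-then on
        ; state-trans = λ {ρ τ} on σ → to (⊨-inlᵀ-inlᵀ ρ σ τ (φT A)) ∘ branch-then on
        ; state-final = λ {M} on → to (⊨-inl-inl M (φF A)) ∘ branch-then on }

      ∪A-retractʳ : Simulation (A ∪A B) B (λ M → ¬ M ⊨ flag)
      ∪A-retractʳ = record
        { state       = reductʳ ∘ reductˡ
        ; state-rigid = SameRigid-reductʳ ∘ SameRigid-reductˡ
        ; state-init  = λ {M} off → to (⊨-inl-inr M (φ₀ B)) ∘ branch-else off
        ; state-trans = λ {ρ τ} off σ → to (⊨-inlᵀ-inrᵀ ρ σ τ (φT B)) ∘ branch-else off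
        ; state-final = λ {M} off → to (⊨-inl-inr M (φF B)) ∘ branch-else off }

      flag-constant : (r : Accepts (A ∪A B) w) (i : Fin (suc (len w))) →
                      Run.ρ r i ⊨ flag ⇔ Run.ρ r zero ⊨ flag
      flag-constant r i = proj₂ (Run.rigid r i zero) (inj₂ tt) refl []

      accepts-∪A : Accepts (A ∪A B) w ⇔ (Accepts A w ⊎ Accepts B w)
      accepts-∪A = mk⇔ retract λ { (inj₁ r) → simulate ∪A-injˡ r _
                                 ; (inj₂ s) → simulate ∪A-injʳ s _ }
        where
        retract : Accepts (A ∪A B) w → Accepts A w ⊎ Accepts B w
        retract r with Run.init r
        ... | inj₁ (on , _)  = inj₁ (simulate ∪A-retractˡ r λ i → from (flag-constant r i) on)
        ... | inj₂ (off , _) = inj₂ (simulate ∪A-retractʳ r λ i → off ∘ to (flag-constant r i))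

  module _ {Ξ : Sig Sort} {T : Theory Ξ} {L₁ L₂ : TLang Ξ T} where

    Regular-∩ : Regular L₁ → Regular L₂ → Regular (L₁ ∩L L₂)
    Regular-∩ (A₁ , L₁⇔A₁) (A₂ , L₂⇔A₂) =
      A₁ ∩A A₂ , λ w → ⇔-sym (accepts-∩A w) ⇔-∘ (L₁⇔A₁ w ×-⇔ L₂⇔A₂ w)

    Regular-∪ : Regular L₁ → Regular L₂ → Regular (L₁ ∪L L₂)
    Regular-∪ (A₁ , L₁⇔A₁) (A₂ , L₂⇔A₂) =
      A₁ ∪A A₂ , λ w → ⇔-sym (accepts-∪A w) ⇔-∘ (L₁⇔A₁ w ⊎-⇔ L₂⇔A₂ w)

theorem2 : {Sort : Set} (Ξ : Sig Sort) → FiniteSig Ξ → (T : Theory Ξ) →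
    (L₁ L₂ : TLang Ξ T) → Regular L₁ → Regular L₂ →
    Regular (L₁ ∩L L₂) × Regular (L₁ ∪L L₂)
theorem2 _ _ _ _ _ L₁-regular L₂-regular =
  Regular-∩ L₁-regular L₂-regular , Regular-∪ L₁-regular L₂-regular
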